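{- Let $(\mathcal{C},\mathcal{M})$ be an AECat with AP, and let $((A_i)_{i\in I};M)$ and $((A'_i)_{i\in I};M')$ be two tuples of subobjects of models $M$ and $M'$. Then $\operatorname{gtp}((A_i)_{i\in I};M)=\operatorname{gtp}((A'_i)_{i\in I};M')$ if and only if for any representatives $(a_i)_{i\in I}$ of $(A_i)_{i\in I}$ there are representatives $(a'_i)_{i\in I}$ of $(A'_i)_{i\in I}$ such that $\operatorname{gtp}((a_i)_{i\in I};M)=\operatorname{gtp}((a'_i)_{i\in I};M')$.
   Context: An AECat is a pair $(\mathcal{C},\mathcal{M})$ where $\mathcal{C}$ and $\mathcal{M}$ are accessible categories, $\mathcal{M}$ is a full subcategory of $\mathcal{C}$, $\mathcal{M}$ has directed colimits and the inclusion preserves them, and every arrow of $\mathcal{C}$ is a monomorphism. Objects of $\mathcal{M}$ are models. AP: every span $N_1\leftarrow M\to N_2$ in $\mathcal{M}$ has a commuting cospan $N_1\to U\leftarrow N_2$ in $\mathcal{M}$. An extension of a model $M$ is an arrow $M\to N$ with $N$ a model. For arrows $a_i$ into a model $M$ and $a'_i$ into a model $M'$: $\operatorname{gtp}((a_i)_{i\in I};M)=\operatorname{gtp}((a'_i)_{i\in I};M')$ means $\operatorname{dom}(a_i)=\operatorname{dom}(a'_i)$ for all $i$ and there are extensions $f:M\to N$, $g:M'\to N$ with $fa_i=ga'_i$ for all $i$. For tuples of subobjects, $\operatorname{gtp}((A_i)_{i\in I};M)=\operatorname{gtp}((A'_i)_{i\in I};M')$ means there are extensions $M\to N\leftarrow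 M'$ such that, after composing with them, $A_i=A'_i$ as subobjects of $N$ for all $i$. -}

module Defs where

open import Level using (Level; _⊔_; Lift) renaming (suc to lsuc)
open import Data.Nat using (ℕ)
open import Data.Fin using (Fin)
open import Data.Product using (Σ; Σ-syntax; ∃; ∃-syntax; _×_; _,_)
open import Relation.Nullary using (¬_)
open import Relation.Binary.Core using (Rel)
open import Relation.Binary.Structures using (IsEquivalence)
open import Function.Bundles using (_↣_)

record Category (o ℓ e : Level) : Set (lsuc (o ⊔ ℓ ⊔ e)) where
  infixr 9 _∘_
  infix  4 _≈_
  infixr 2 _⇒_
  field
    Obj   : Set o
    _⇒_   : Obj → Obj → Set ℓ
    _≈_   : ∀ {A B} → Rel (A ⇒ B) e
    id    : ∀ {A} → A ⇒ A
    _∘_   : ∀ {A B C} → B ⇒ C → A ⇒ B → A ⇒ C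
    ≈-equiv    : ∀ {A B} → IsEquivalence (_≈_ {A} {B})
    ∘-resp-≈   : ∀ {A B C} {f h : B ⇒ C} {g i : A ⇒ B} →
                 f ≈ h → g ≈ i → f ∘ g ≈ h ∘ i
    identityˡ  : ∀ {A B} {f : A ⇒ B} → id ∘ f ≈ f
    identityʳ  : ∀ {A B} {f : A ⇒ B} → f ∘ id ≈ f
    assoc      : ∀ {A B C D} {f : A ⇒ B} {g : B ⇒ C} {h : C ⇒ D} →
                 (h ∘ g) ∘ f ≈ h ∘ (g ∘ f)

-- Regular cardinals, encoded (up to equipotence) as the class of
-- "small" types in Set ℓ of cardinality < λ.

record RegularCardinal (ℓ : Level) : Set (lsuc ℓ) where
  field
    Small     : Set ℓ → Set ℓ
    -- λ is infinite: every finite type has size < λ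
    fin-small : ∀ (n : ℕ) → Small (Lift ℓ (Fin n))
    inj-small : ∀ {A B : Set ℓ} → A ↣ B → Small B → Small A
    -- regularity: a union of < λ many sets of size < λ has size < λ
    Σ-small   : ∀ {A : Set ℓ} {B : A → Set ℓ} →
                Small A → (∀ a → Small (B a)) → Small (Σ A B)
    -- λ is a genuine cardinal (not all of Set ℓ)
    bounded   : Σ[ A ∈ Set ℓ ] ¬ Small A

record DirectedPreorder (ℓ : Level) : Set (lsuc ℓ) where
  field
    Carrier  : Set ℓ
    _≤_      : Carrier → Carrier → Set ℓ
    ≤-refl   : ∀ {i} → i ≤ i
    ≤-trans  : ∀ {i j k} → i ≤ j → j ≤ k → i ≤ k
    inhabited : Carrier
    upper    : ∀ i j → Σ[ k ∈ Carrier ] (i ≤ k × j ≤ k)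

IsλDirected : ∀ {ℓ} → RegularCardinal ℓ → DirectedPreorder ℓ → Set (lsuc ℓ)
IsλDirected {ℓ} κ D =
  ∀ (S : Set ℓ) → Small S → (s : S → Carrier) →
    Σ[ k ∈ Carrier ] (∀ x → s x ≤ k)
  where
    open RegularCardinal κ
    open DirectedPreorder D

module _ {o ℓ e : Level} (C : Category o ℓ e) where
  open Category C

  record Diagram (D : DirectedPreorder ℓ) : Set (o ⊔ ℓ ⊔ e) where
    open DirectedPreorder D
    field
      F₀     : Carrier → Obj
      F₁     : ∀ {i j} → i ≤ j → F₀ i ⇒ F₀ j
      F-thin : ∀ {i j} (p q : i ≤ j) → F₁ p ≈ F₁ q
      F-id   : ∀ {i} → F₁ (≤-refl {i}) ≈ id
      F-comp : ∀ {i j k} (p : i ≤ j) (q : j ≤ k) →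
               F₁ (≤-trans p q) ≈ F₁ q ∘ F₁ p

  record Cocone {D : DirectedPreorder ℓ} (F : Diagram D) (X : Obj)
         : Set (o ⊔ ℓ ⊔ e) where
    open DirectedPreorder D
    open Diagram F
    field
      ι       : ∀ i → F₀ i ⇒ X
      commute : ∀ {i j} (p : i ≤ j) → ι j ∘ F₁ p ≈ ι i

  IsColimit : ∀ {D : DirectedPreorder ℓ} {F : Diagram D} {X : Obj} →
              Cocone F X → Set (o ⊔ ℓ ⊔ e)
  IsColimit {D} {F} {X} c =
    ∀ {Y : Obj} (c' : Cocone F Y) →
      Σ[ u ∈ X ⇒ Y ]
        ((∀ i → u ∘ Cocone.ι c i ≈ Cocone.ι c' i) ×
         (∀ (v : X ⇒ Y) → (∀ i → v ∘ Cocone.ι c i ≈ Cocone.ι c' i) → v ≈ u))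
    where open DirectedPreorder D

  HasColimit : ∀ {D : DirectedPreorder ℓ} → Diagram D → Set (o ⊔ ℓ ⊔ e)
  HasColimit F = Σ[ X ∈ Obj ] Σ[ c ∈ Cocone F X ] IsColimit c

  record Iso (A B : Obj) : Set (ℓ ⊔ e) where
    field
      to    : A ⇒ B
      from  : B ⇒ A
      isoˡ  : from ∘ to ≈ id
      isoʳ  : to ∘ from ≈ id

  Mono : ∀ {A B} → A ⇒ B → Set (o ⊔ ℓ ⊔ e)
  Mono {A} f = ∀ {Z} (g h : Z ⇒ A) → f ∘ g ≈ f ∘ h → g ≈ h

  -- P is λ-presentable: Hom(P,-) preserves λ-directed colimits,
  -- i.e. maps P → colim factor essentially uniquely through a stage.
  IsPresentable : ∀ (κ : RegularCardinal ℓ) → Obj → Set (o ⊔ lsuc ℓ ⊔ e)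
  IsPresentable κ P =
    ∀ (D : DirectedPreorder ℓ) → IsλDirected κ D →
    ∀ (F : Diagram D) {X : Obj} (c : Cocone F X) → IsColimit c →
      (∀ (f : P ⇒ X) →
         Σ[ i ∈ DirectedPreorder.Carrier D ]
         Σ[ g ∈ P ⇒ Diagram.F₀ F i ] Cocone.ι c i ∘ g ≈ f)
      ×
      (∀ {i} (g h : P ⇒ Diagram.F₀ F i) →
         Cocone.ι c i ∘ g ≈ Cocone.ι c i ∘ h →
         Σ[ j ∈ DirectedPreorder.Carrier D ]
         Σ[ p ∈ DirectedPreorder._≤_ D i j ]
           Diagram.F₁ F p ∘ g ≈ Diagram.F₁ F p ∘ h)

  Accessible : Set (o ⊔ lsuc ℓ ⊔ e)
  Accessible =
    Σ[ κ ∈ RegularCardinal ℓ ]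
      ((∀ (D : DirectedPreorder ℓ) → IsλDirected κ D →
          (F : Diagram D) → HasColimit F)
      ×
       Σ[ K ∈ Set ℓ ] Σ[ P ∈ (K → Obj) ]
         ((∀ k → IsPresentable κ (P k))
         ×
          (∀ (X : Obj) →
             Σ[ D ∈ DirectedPreorder ℓ ] (IsλDirected κ D ×
             Σ[ F ∈ Diagram D ]
               ((∀ d → Σ[ k ∈ K ] Iso (Diagram.F₀ F d) (P k)) ×
                Σ[ c ∈ Cocone F X ] IsColimit c)))))

FullSub : ∀ {o ℓ e m} (C : Category o ℓ e) →
          (Category.Obj C → Set m) → Category (o ⊔ m) ℓ e
FullSub C P = record
  { Obj       = Σ[ X ∈ Obj ] P X
  ; _⇒_       = λ A B → Σ.proj₁ A ⇒ Σ.proj₁ B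
  ; _≈_       = _≈_
  ; id        = id
  ; _∘_       = _∘_
  ; ≈-equiv   = ≈-equiv
  ; ∘-resp-≈  = ∘-resp-≈
  ; identityˡ = identityˡ
  ; identityʳ = identityʳ
  ; assoc     = assoc
  }
  where open Category C

record AECat (o ℓ e m : Level) : Set (lsuc (o ⊔ ℓ ⊔ e ⊔ m)) where
  field
    C        : Category o ℓ e
  open Category C public
  field
    IsModel  : Obj → Set m
    C-accessible : Accessible C
    M-accessible : Accessible (FullSub C IsModel)
    -- M has directed colimits and the inclusion M ↪ C preserves them
    M-directed-colimits :
      ∀ (D : DirectedPreorder ℓ) (F : Diagram C D) →
      (∀ d → IsModel (Diagram.F₀ F d)) →
      Σ[ X ∈ Obj ] (IsModel X × Σ[ c ∈ Cocone C F X ] IsColimit C c)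
    all-mono : ∀ {A B} (f : A ⇒ B) → Mono C f

module _ {o ℓ e m} (𝔸 : AECat o ℓ e m) where
  open AECat 𝔸

  HasAP : Set (o ⊔ ℓ ⊔ e ⊔ m)
  HasAP = ∀ {M N₁ N₂} → IsModel M → IsModel N₁ → IsModel N₂ →
          (f : M ⇒ N₁) (g : M ⇒ N₂) →
          Σ[ U ∈ Obj ] (IsModel U × Σ[ u₁ ∈ N₁ ⇒ U ] Σ[ u₂ ∈ N₂ ⇒ U ]
            (u₁ ∘ f ≈ u₂ ∘ g))

  GtpArrEq : ∀ {ι} {I : Set ι} {X : I → Obj} {M M' : Obj} →
             (a : ∀ i → X i ⇒ M) (a' : ∀ i → X i ⇒ M') → Set (o ⊔ ℓ ⊔ e ⊔ m ⊔ ι)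
  GtpArrEq {M = M} {M'} a a' =
    Σ[ N ∈ Obj ] (IsModel N × Σ[ f ∈ M ⇒ N ] Σ[ g ∈ M' ⇒ N ]
      (∀ i → f ∘ a i ≈ g ∘ a' i))

  -- a subobject of M, given by a representative arrow into M
  -- (every arrow is a monomorphism in an AECat)
  record Sub (M : Obj) : Set (o ⊔ ℓ) where
    constructor sub
    field
      dom : Obj
      arr : dom ⇒ M

  SameSub : ∀ {M} → Sub M → Sub M → Set (ℓ ⊔ e)
  SameSub A B = (Σ[ h ∈ Sub.dom A ⇒ Sub.dom B ] Sub.arr B ∘ h ≈ Sub.arr A)
              × (Σ[ k ∈ Sub.dom B ⇒ Sub.dom A ] Sub.arr A ∘ k ≈ Sub.arr B)

  push : ∀ {M N} → M ⇒ N → Sub M → Sub N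
  push f A = sub (Sub.dom A) (f ∘ Sub.arr A)

  GtpSubEq : ∀ {ι} {I : Set ι} {M M' : Obj} →
             (A : I → Sub M) (A' : I → Sub M') → Set (o ⊔ ℓ ⊔ e ⊔ m ⊔ ι)
  GtpSubEq {M = M} {M'} A A' =
    Σ[ N ∈ Obj ] (IsModel N × Σ[ f ∈ M ⇒ N ] Σ[ g ∈ M' ⇒ N ]
      (∀ i → SameSub (push f (A i)) (push g (A' i))))

module Submission where

-- The key lemma `realise` says: if  f·a  and  g·B  are the same subobject
-- of N, then B has a representative  a'  with the same domain as  a  and
-- f ∘ a ≈ g ∘ a'.
--   (⇒) Given a representative tuple a of A and a witness  f·A ≅ g·A',
--       we get  f·a ≅ f·A ≅ g·A'  and apply `realise` componentwise.
--   (⇐) Apply the hypothesis to the tuple A itself; the resulting a'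
--       satisfies  f·A ≅ g·a' ≅ g·A'.

open import Defs
open import Level using (_⊔_)
open import Data.Product using (Σ-syntax; _×_; _,_; proj₁; proj₂)
open import Function.Bundles using (_⇔_; mk⇔)
open import Relation.Binary.Bundles using (Setoid)
import Relation.Binary.Reasoning.Setoid as SetoidReasoning

module Subobjects {o ℓ e m} (𝔸 : AECat o ℓ e m) where
  open AECat 𝔸

  hom : Obj → Obj → Setoid ℓ e
  hom X Y = record { Carrier = X ⇒ Y ; _≈_ = _≈_ ; isEquivalence = ≈-equiv }

  module ≈ {X Y : Obj} = Setoid (hom X Y)

  ◃ : ∀ {X Y Z} (h : Y ⇒ Z) {f g : X ⇒ Y} → f ≈ g → h ∘ f ≈ h ∘ g
  ◃ h p = ∘-resp-≈ ≈.refl p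

  ▹ : ∀ {X Y Z} {f g : Y ⇒ Z} (h : X ⇒ Y) → f ≈ g → f ∘ h ≈ g ∘ h
  ▹ h p = ∘-resp-≈ p ≈.refl

  ≈⇒SameSub : ∀ {X Y} {f g : X ⇒ Y} → f ≈ g → SameSub 𝔸 (sub X f) (sub X g)
  ≈⇒SameSub p = (id , ≈.trans identityʳ (≈.sym p)) , (id , ≈.trans identityʳ p)

  SameSub-refl : ∀ {Y} (A : Sub 𝔸 Y) → SameSub 𝔸 A A
  SameSub-refl (sub X a) = ≈⇒SameSub ≈.refl

  SameSub-trans : ∀ {Y} {A B C : Sub 𝔸 Y} →
                  SameSub 𝔸 A B → SameSub 𝔸 B C → SameSub 𝔸 A C
  SameSub-trans {A = sub _ a} {sub _ b} {sub _ c} ((h , bh) , (k , ak)) ((h' , ch') , (k' , bk')) =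
      (h' ∘ h , compose ch' bh) , (k ∘ k' , compose ak bk')
    where
      compose : ∀ {X Y Z W} {u : Y ⇒ W} {v : X ⇒ W} {w : Z ⇒ W} {r : X ⇒ Y} {s : Y ⇒ Z} →
                w ∘ s ≈ u → u ∘ r ≈ v → w ∘ (s ∘ r) ≈ v
      compose {u = u} {v} {w} {r} {s} ws ur = begin
        w ∘ (s ∘ r)  ≈⟨ assoc ⟨
        (w ∘ s) ∘ r  ≈⟨ ▹ r ws ⟩
        u ∘ r        ≈⟨ ur ⟩
        v            ∎
        where open SetoidReasoning (hom _ _)

  push-SameSub : ∀ {Y Z} (f : Y ⇒ Z) {A B : Sub 𝔸 Y} →
                 SameSub 𝔸 A B → SameSub 𝔸 (push 𝔸 f A) (push 𝔸 f B)
  push-SameSub f ((h , bh) , (k , ak)) =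
    (h , ≈.trans assoc (◃ f bh)) , (k , ≈.trans assoc (◃ f ak))

  mono-reflects-SameSub : ∀ {Y Z} {g : Y ⇒ Z} → Mono C g → {A B : Sub 𝔸 Y} →
                          SameSub 𝔸 (push 𝔸 g A) (push 𝔸 g B) → SameSub 𝔸 A B
  mono-reflects-SameSub g-mono ((h , gbh) , (k , gak)) =
    (h , g-mono _ _ (≈.trans (≈.sym assoc) gbh)) ,
    (k , g-mono _ _ (≈.trans (≈.sym assoc) gak))

  -- Namely a' = B ∘ h for the
  -- comparison map h; that it still represents B uses that g is mono.
  realise : ∀ {Y Y' N} {f : Y ⇒ N} {g : Y' ⇒ N} (a : Sub 𝔸 Y) (B : Sub 𝔸 Y') →
            SameSub 𝔸 (push 𝔸 f a) (push 𝔸 g B) →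
            Σ[ a' ∈ Sub.dom a ⇒ Y' ]
              (SameSub 𝔸 (sub (Sub.dom a) a') B × f ∘ Sub.arr a ≈ g ∘ a')
  realise {f = f} {g} (sub X a) (sub _ b) fa≅gb@((h , gbh) , _) =
      b ∘ h , mono-reflects-SameSub (all-mono g) ga'≅gb , ≈.sym ga'≈fa
    where
      ga'≈fa : g ∘ (b ∘ h) ≈ f ∘ a
      ga'≈fa = ≈.trans (≈.sym assoc) gbh

      ga'≅gb : SameSub 𝔸 (sub X (g ∘ (b ∘ h))) (sub _ (g ∘ b))
      ga'≅gb = SameSub-trans (≈⇒SameSub ga'≈fa) fa≅gb

module _ {o ℓ e m ι} (𝔸 : AECat o ℓ e m) {I : Set ι} {M M' : AECat.Obj 𝔸}
         (A : I → Sub 𝔸 M) (A' : I → Sub 𝔸 M') where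
  open AECat 𝔸
  open Subobjects 𝔸

  RepresentativesMatch : Set (o ⊔ ℓ ⊔ e ⊔ m ⊔ ι)
  RepresentativesMatch =
    ∀ (a : I → Sub 𝔸 M) → (∀ i → SameSub 𝔸 (a i) (A i)) →
      Σ[ a' ∈ ((i : I) → Sub.dom (a i) ⇒ M') ]
        ((∀ i → SameSub 𝔸 (sub (Sub.dom (a i)) (a' i)) (A' i))
        × GtpArrEq 𝔸 (λ i → Sub.arr (a i)) a')

  -- (⇒) A witness f·A ≅ g·A' gives f·a ≅ g·A', which `realise` turns into
  -- representatives a' of A' with f ∘ a ≈ g ∘ a', all in the same model N.
  gtpSub⇒representatives : GtpSubEq 𝔸 A A' → RepresentativesMatch
  gtpSub⇒representatives (N , N-model , f , g , fA≅gA') a a≅A =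
      (λ i → proj₁ (matched i)) , (λ i → proj₁ (proj₂ (matched i))) ,
      N , N-model , f , g , (λ i → proj₂ (proj₂ (matched i)))
    where
      matched : ∀ i → Σ[ a' ∈ Sub.dom (a i) ⇒ M' ]
                  (SameSub 𝔸 (sub (Sub.dom (a i)) a') (A' i) × f ∘ Sub.arr (a i) ≈ g ∘ a')
      matched i = realise (a i) (A' i)
                    (SameSub-trans (push-SameSub f (a≅A i)) (fA≅gA' i))

  -- (⇐) Use A itself as its representative tuple: the matching a' has
  -- f·A ≅ g·a' ≅ g·A' in the common extension N.
  representatives⇒gtpSub : RepresentativesMatch → GtpSubEq 𝔸 A A'
  representatives⇒gtpSub match
    with match A (λ i → SameSub-refl (A i))
  ... | a' , a'≅A' , N , N-model , f , g , fA≈ga' =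
      N , N-model , f , g ,
      λ i → SameSub-trans (≈⇒SameSub (fA≈ga' i)) (push-SameSub g (a'≅A' i))

proposition3p6 : ∀ {o ℓ e m ι} (𝔸 : AECat o ℓ e m) → HasAP 𝔸 →
    (I : Set ι) (M M' : AECat.Obj 𝔸) → AECat.IsModel 𝔸 M → AECat.IsModel 𝔸 M' →
    (A : I → Sub 𝔸 M) (A' : I → Sub 𝔸 M') →
    GtpSubEq 𝔸 A A' ⇔
      (∀ (a : I → Sub 𝔸 M) → (∀ i → SameSub 𝔸 (a i) (A i)) →
        Σ[ a' ∈ ((i : I) → AECat._⇒_ 𝔸 (Sub.dom (a i)) M') ]
          ((∀ i → SameSub 𝔸 (sub (Sub.dom (a i)) (a' i)) (A' i))
          × GtpArrEq 𝔸 (λ i → Sub.arr (a i)) a'))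
proposition3p6 𝔸 _ I M M' _ _ A A' =
  mk⇔ (gtpSub⇒representatives 𝔸 A A') (representatives⇒gtpSub 𝔸 A A')
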